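{- Let $d_1,d_2\ge 2$ and $n\ge 1$. If $A$ is a $d_1$-dimensional permutation of order $n$ and $B$ is a vertex of $\Omega^{d_2}_{n}$, then the dot product $A \cdot B$ is a vertex of $\Omega^{d_1 + d_2 -2}_{n}$.
   Context: A $d$-dimensional matrix of order $n$ is an array $A=(a_\alpha)_{\alpha\in I_n^d}$ of real numbers, where $I_n^d=\{(\alpha_1,\dots,\alpha_d): \alpha_i\in\{1,\dots,n\}\}$. A line of $A$ is the set of entries obtained by fixing all indices but one and letting the remaining index run from $1$ to $n$. $A$ is polystochastic if all entries are nonnegative and the entries on every line sum to $1$. A $d$-dimensional permutation of order $n$ is a polystochastic matrix with all entries in $\{0,1\}$. $\Omega_n^d$ denotes the convex polytope of all $d$-dimensional polystochastic matrices of order $n$; a vertex of $\Omega_n^d$ is an element that cannot be written as a nontrivial convex combination of elements of $\Omega_n^d$. For a $d_1$-dimensional matrix $A$ and a $d_2$-dimensional matrix $B$, both of order $n$, the dot product $C=A\cdot B$ is the $(d_1+d_2-2)$-dimensional matrix of order $n$ with entries $c_\gamma=\sum_{i=1}^n a_{\alpha i}b_{i\beta}$, where $\gamma=\alpha\beta$ is the concatenation of $\alpha\in I_n^{d_1-1}$ and $\beta\in I_n^{d_2-1}$.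
   Formalization: All matrices, including the elements of $\Omega_n^d$ and those in a convex combination, have rational entries rather than real ones, and the coefficient of such a combination is taken in the rationals. -}

module Defs where

open import Data.Nat using (ℕ; zero; suc; _+_)
open import Data.Fin using (Fin; zero; suc)
open import Data.Vec using (Vec; _∷_; _∷ʳ_; _[_]≔_; take; drop)
open import Data.Rational using (ℚ; 0ℚ; 1ℚ) renaming (_+_ to _+ℚ_; _*_ to _*ℚ_; _-_ to _-ℚ_; _≤_ to _≤ℚ_; _<_ to _<ℚ_)
open import Data.Product using (Σ; _×_; _,_)
open import Data.Sum using (_⊎_)
open import Relation.Binary.PropositionalEquality using (_≡_; _≢_)
open import Relation.Nullary using (¬_)

Index : ℕ → ℕ → Set
Index n d = Vec (Fin n) d

Matrix : ℕ → ℕ → Set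
Matrix n d = Index n d → ℚ

sumFin : (n : ℕ) → (Fin n → ℚ) → ℚ
sumFin zero    f = 0ℚ
sumFin (suc n) f = f zero +ℚ sumFin n (λ i → f (suc i))

IsPolystochastic : {n d : ℕ} → Matrix n d → Set
IsPolystochastic {n} {d} A =
  ((α : Index n d) → 0ℚ ≤ℚ A α) ×
  ((k : Fin d) (α : Index n d) → sumFin n (λ i → A (α [ k ]≔ i)) ≡ 1ℚ)

IsPermutation : {n d : ℕ} → Matrix n d → Set
IsPermutation {n} {d} A =
  IsPolystochastic A × ((α : Index n d) → (A α ≡ 0ℚ) ⊎ (A α ≡ 1ℚ))

IsVertex : {n d : ℕ} → Matrix n d → Set
IsVertex {n} {d} B =
  IsPolystochastic B ×
  ¬ (Σ (Matrix n d) λ C → Σ (Matrix n d) λ D → Σ ℚ λ t →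
       IsPolystochastic C × IsPolystochastic D ×
       (0ℚ <ℚ t) × (t <ℚ 1ℚ) ×
       (Σ (Index n d) λ α → C α ≢ D α) ×
       ((α : Index n d) → B α ≡ (t *ℚ C α) +ℚ ((1ℚ -ℚ t) *ℚ D α)))

dot : {n p q : ℕ} → Matrix n (suc p) → Matrix n (suc q) → Matrix n (p + q)
dot {n} {p} {q} A B γ = sumFin n (λ i → A (take p γ ∷ʳ i) *ℚ B (i ∷ drop p γ))

-- Fix α ∈ I_n^p and a coordinate k < p.  The section P(i, j) = A((α with k := j) i) of A
-- is polystochastic, so contracting against it,
--     restrict E (i β) = Σ_j P(i, j) E((α with k := j) β),
-- is linear and preserves polystochasticity.  Because A has 0/1 entries, restrict (A · B) = B,
-- and for the i with A(α i) = 1 the column P(i, ·) is the unit vector at α_k, so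
-- restrict E (i β) = E(α β).  Hence restrict turns a proper convex decomposition of A · B
-- into one of B.
module Submission where

open import Defs
open import Algebra.Bundles using (Ring)
open import Data.Nat using (ℕ; zero; suc; _≤_; _+_; s≤s; z≤n)
open import Data.Fin using (Fin; zero; suc; inject₁; fromℕ; _↑ˡ_; _↑ʳ_; splitAt; join; punchIn)
open import Data.Fin.Properties using (join-splitAt; any?)
open import Data.Vec using (Vec; []; _∷_; _∷ʳ_; _[_]≔_; take; drop; _++_; lookup; head)
open import Data.Vec.Properties using (take++drop≡id; ++-injective; []≔-++-↑ˡ; []≔-++-↑ʳ; []≔-lookup)
open import Data.Vec.Functional using (removeAt)
open import Data.Rational using (ℚ; 0ℚ; 1ℚ; _≟_)
  renaming (_+_ to _+ℚ_; _*_ to _*ℚ_; _-_ to _-ℚ_; _≤_ to _≤ℚ_; _<_ to _<ℚ_)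
open import Data.Rational.Base using (nonNegative)
import Data.Rational.Properties as ℚ
open import Data.Rational.Solver using (module +-*-Solver)
open import Algebra.Properties.Group ℚ.+-0-group using (∙-cancelˡ)
open import Algebra.Properties.Semiring.Sum (Ring.semiring ℚ.+-*-ring)
  using (sum; sum-cong-≗; ∑-comm; ∑-distrib-+; sum-remove; sum-replicate-zero;
         *-distribˡ-sum; *-distribʳ-sum)
open import Data.Product using (Σ; ∃; _×_; _,_; proj₁; proj₂)
open import Data.Sum using (_⊎_; inj₁; inj₂; fromInj₁)
open import Function using (_∘_)
open import Relation.Nullary using (yes; no; contradiction)
open import Relation.Binary.PropositionalEquality
open ≡-Reasoning

private
  variable
    n p q : ℕ

sumFin≡sum : ∀ n (f : Fin n → ℚ) → sumFin n f ≡ sum f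
sumFin≡sum zero    f = refl
sumFin≡sum (suc n) f = cong (f zero +ℚ_) (sumFin≡sum n (f ∘ suc))

sumFin-cong : ∀ n {f g : Fin n → ℚ} → f ≗ g → sumFin n f ≡ sumFin n g
sumFin-cong n {f} {g} f≗g = begin
  sumFin n f  ≡⟨ sumFin≡sum n f ⟩
  sum f       ≡⟨ sum-cong-≗ f≗g ⟩
  sum g       ≡⟨ sumFin≡sum n g ⟨
  sumFin n g  ∎

sumFin-zero : ∀ n → sumFin n (λ _ → 0ℚ) ≡ 0ℚ
sumFin-zero n = trans (sumFin≡sum n _) (sum-replicate-zero n)

sumFin-+ : ∀ n (f g : Fin n → ℚ) → sumFin n (λ i → f i +ℚ g i) ≡ sumFin n f +ℚ sumFin n g
sumFin-+ n f g = begin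
  sumFin n (λ i → f i +ℚ g i)  ≡⟨ sumFin≡sum n _ ⟩
  sum (λ i → f i +ℚ g i)       ≡⟨ ∑-distrib-+ f g ⟩
  sum f +ℚ sum g               ≡⟨ cong₂ _+ℚ_ (sumFin≡sum n f) (sumFin≡sum n g) ⟨
  sumFin n f +ℚ sumFin n g     ∎

sumFin-*ˡ : ∀ n c (f : Fin n → ℚ) → c *ℚ sumFin n f ≡ sumFin n (λ i → c *ℚ f i)
sumFin-*ˡ n c f = begin
  c *ℚ sumFin n f             ≡⟨ cong (c *ℚ_) (sumFin≡sum n f) ⟩
  c *ℚ sum f                  ≡⟨ *-distribˡ-sum c f ⟩
  sum (λ i → c *ℚ f i)        ≡⟨ sumFin≡sum n _ ⟨
  sumFin n (λ i → c *ℚ f i)   ∎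

sumFin-*ʳ : ∀ n c (f : Fin n → ℚ) → sumFin n f *ℚ c ≡ sumFin n (λ i → f i *ℚ c)
sumFin-*ʳ n c f = begin
  sumFin n f *ℚ c             ≡⟨ cong (_*ℚ c) (sumFin≡sum n f) ⟩
  sum f *ℚ c                  ≡⟨ *-distribʳ-sum c f ⟩
  sum (λ i → f i *ℚ c)        ≡⟨ sumFin≡sum n _ ⟨
  sumFin n (λ i → f i *ℚ c)   ∎

sumFin-comm : ∀ m n (f : Fin m → Fin n → ℚ) →
  sumFin m (λ i → sumFin n (f i)) ≡ sumFin n (λ j → sumFin m (λ i → f i j))
sumFin-comm m n f = begin
  sumFin m (λ i → sumFin n (f i))          ≡⟨ sumFin-cong m (λ i → sumFin≡sum n (f i)) ⟩
  sumFin m (λ i → sum (f i))               ≡⟨ sumFin≡sum m _ ⟩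
  sum (λ i → sum (f i))                    ≡⟨ ∑-comm f ⟩
  sum (λ j → sum (λ i → f i j))            ≡⟨ sumFin≡sum n _ ⟨
  sumFin n (λ j → sum (λ i → f i j))       ≡⟨ sumFin-cong n (λ j → sumFin≡sum m (λ i → f i j)) ⟨
  sumFin n (λ j → sumFin m (λ i → f i j))  ∎

sumFin-removeAt : ∀ n (f : Fin (suc n) → ℚ) i → sumFin (suc n) f ≡ f i +ℚ sumFin n (removeAt f i)
sumFin-removeAt n f i = begin
  sumFin (suc n) f                   ≡⟨ sumFin≡sum (suc n) f ⟩
  sum f                              ≡⟨ sum-remove f ⟩
  f i +ℚ sum (removeAt f i)          ≡⟨ cong (f i +ℚ_) (sumFin≡sum n (removeAt f i)) ⟨
  f i +ℚ sumFin n (removeAt f i)     ∎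

sumFin-nonNeg : ∀ n {f : Fin n → ℚ} → (∀ i → 0ℚ ≤ℚ f i) → 0ℚ ≤ℚ sumFin n f
sumFin-nonNeg zero    f≥0 = ℚ.≤-refl
sumFin-nonNeg (suc n) f≥0 = ℚ.+-mono-≤ (f≥0 zero) (sumFin-nonNeg n (f≥0 ∘ suc))

≤-sumFin : ∀ n {f : Fin n → ℚ} → (∀ i → 0ℚ ≤ℚ f i) → ∀ i → f i ≤ℚ sumFin n f
≤-sumFin (suc n) {f} f≥0 i =
  subst₂ _≤ℚ_ (ℚ.+-identityʳ (f i)) (sym (sumFin-removeAt n f i))
    (ℚ.+-monoʳ-≤ (f i) (sumFin-nonNeg n (f≥0 ∘ punchIn i)))

sumFin≡0⇒≡0 : ∀ n {f : Fin n → ℚ} → (∀ i → 0ℚ ≤ℚ f i) → sumFin n f ≡ 0ℚ → ∀ i → f i ≡ 0ℚ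
sumFin≡0⇒≡0 n f≥0 Σf≡0 i = ℚ.≤-antisym (subst (_ ≤ℚ_) Σf≡0 (≤-sumFin n f≥0 i)) (f≥0 i)

sumFin-select : ∀ n {f : Fin n → ℚ} (g : Fin n → ℚ) → (∀ i → 0ℚ ≤ℚ f i) →
  sumFin n f ≡ 1ℚ → ∀ {i} → f i ≡ 1ℚ → sumFin n (λ l → f l *ℚ g l) ≡ g i
sumFin-select (suc n) {f} g f≥0 Σf≡1 {i} fi≡1 = begin
  sumFin (suc n) (λ l → f l *ℚ g l)                        ≡⟨ sumFin-removeAt n (λ l → f l *ℚ g l) i ⟩
  f i *ℚ g i +ℚ sumFin n (removeAt (λ l → f l *ℚ g l) i)  ≡⟨ cong₂ _+ℚ_ (cong (_*ℚ g i) fi≡1) rest≡0 ⟩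
  1ℚ *ℚ g i +ℚ 0ℚ                                          ≡⟨ ℚ.+-identityʳ (1ℚ *ℚ g i) ⟩
  1ℚ *ℚ g i                                                ≡⟨ ℚ.*-identityˡ (g i) ⟩
  g i                                                      ∎
  where
  others≡0 : ∀ l → removeAt f i l ≡ 0ℚ
  others≡0 = sumFin≡0⇒≡0 n (f≥0 ∘ punchIn i) (∙-cancelˡ 1ℚ _ 0ℚ (begin
    1ℚ +ℚ sumFin n (removeAt f i)   ≡⟨ cong (_+ℚ sumFin n (removeAt f i)) fi≡1 ⟨
    f i +ℚ sumFin n (removeAt f i)  ≡⟨ sumFin-removeAt n f i ⟨
    sumFin (suc n) f                ≡⟨ Σf≡1 ⟩
    1ℚ                              ≡⟨ ℚ.+-identityʳ 1ℚ ⟨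
    1ℚ +ℚ 0ℚ                        ∎))

  rest≡0 : sumFin n (removeAt (λ l → f l *ℚ g l) i) ≡ 0ℚ
  rest≡0 = trans (sumFin-cong n zero-terms) (sumFin-zero n)
    where
    zero-terms : ∀ l → f (punchIn i l) *ℚ g (punchIn i l) ≡ 0ℚ
    zero-terms l = trans (cong (_*ℚ g (punchIn i l)) (others≡0 l)) (ℚ.*-zeroˡ (g (punchIn i l)))

sumFin≡1⇒∃≡1 : ∀ n {f : Fin n → ℚ} → (∀ i → f i ≡ 0ℚ ⊎ f i ≡ 1ℚ) → sumFin n f ≡ 1ℚ → ∃ λ i → f i ≡ 1ℚ
sumFin≡1⇒∃≡1 n {f} f∈01 Σf≡1 with any? (λ i → f i ≟ 1ℚ)
... | yes found = found
... | no none   = contradiction (trans (sym Σf≡1) (trans (sumFin-cong n all≡0) (sumFin-zero n))) (λ ())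
  where
  all≡0 : ∀ i → f i ≡ 0ℚ
  all≡0 i = fromInj₁ (λ fi≡1 → contradiction (i , fi≡1) none) (f∈01 i)

*-nonNeg : ∀ {a b} → 0ℚ ≤ℚ a → 0ℚ ≤ℚ b → 0ℚ ≤ℚ a *ℚ b
*-nonNeg {a} {b} a≥0 b≥0 =
  ℚ.nonNegative⁻¹ _ {{ℚ.nonNeg*nonNeg⇒nonNeg a {{nonNegative a≥0}} b {{nonNegative b≥0}}}}

module _ {X : Set} where

  []≔-∷ʳ-inject₁ : (xs : Vec X p) (x y : X) (i : Fin p) → (xs ∷ʳ x) [ inject₁ i ]≔ y ≡ (xs [ i ]≔ y) ∷ʳ x
  []≔-∷ʳ-inject₁ (_ ∷ xs) x y zero    = refl
  []≔-∷ʳ-inject₁ (z ∷ xs) x y (suc i) = cong (z ∷_) ([]≔-∷ʳ-inject₁ xs x y i)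

  []≔-∷ʳ-fromℕ : (xs : Vec X p) (x y : X) → (xs ∷ʳ x) [ fromℕ p ]≔ y ≡ xs ∷ʳ y
  []≔-∷ʳ-fromℕ []       x y = refl
  []≔-∷ʳ-fromℕ (z ∷ xs) x y = cong (z ∷_) ([]≔-∷ʳ-fromℕ xs x y)

firstLine-sum : {B : Matrix n (suc q)} → IsPolystochastic B →
  ∀ j (β : Index n q) → sumFin n (λ i → B (i ∷ β)) ≡ 1ℚ
firstLine-sum PB j β = proj₂ PB zero (j ∷ β)

lastLine-sum : {A : Matrix n (suc p)} → IsPolystochastic A →
  ∀ (α : Index n p) j → sumFin n (λ i → A (α ∷ʳ i)) ≡ 1ℚ
lastLine-sum {n} {p} {A} PA α j =
  trans (sumFin-cong n (λ i → cong A (sym ([]≔-∷ʳ-fromℕ α j i)))) (proj₂ PA (fromℕ p) (α ∷ʳ j))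

innerLine-sum : {A : Matrix n (suc p)} → IsPolystochastic A →
  ∀ (α : Index n p) k i → sumFin n (λ m → A ((α [ k ]≔ m) ∷ʳ i)) ≡ 1ℚ
innerLine-sum {n} {A = A} PA α k i =
  trans (sumFin-cong n (λ m → cong A (sym ([]≔-∷ʳ-inject₁ α i m k)))) (proj₂ PA (inject₁ k) (α ∷ʳ i))

++-lines : {E : Matrix n (p + q)} →
  (∀ (α : Index n p) β k → sumFin n (λ m → E ((α [ k ]≔ m) ++ β)) ≡ 1ℚ) →
  (∀ (α : Index n p) β k → sumFin n (λ m → E (α ++ (β [ k ]≔ m))) ≡ 1ℚ) →
  ∀ k γ → sumFin n (λ m → E (γ [ k ]≔ m)) ≡ 1ℚ
++-lines {n} {p} {q} {E} left right k γ =
  subst₂ (λ k γ → sumFin n (λ m → E (γ [ k ]≔ m)) ≡ 1ℚ)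
    (join-splitAt p q k) (take++drop≡id p γ) (line (splitAt p k))
  where
  α : Index n p
  α = take p γ
  β : Index n q
  β = drop p γ
  line : ∀ s → sumFin n (λ m → E ((α ++ β) [ join p q s ]≔ m)) ≡ 1ℚ
  line (inj₁ k) = trans (sumFin-cong n (λ m → cong E ([]≔-++-↑ˡ α β k))) (left α β k)
  line (inj₂ k) = trans (sumFin-cong n (λ m → cong E ([]≔-++-↑ʳ α β k))) (right α β k)

dot-++ : (A : Matrix n (suc p)) (B : Matrix n (suc q)) (α : Index n p) (β : Index n q) →
  dot A B (α ++ β) ≡ sumFin n (λ i → A (α ∷ʳ i) *ℚ B (i ∷ β))
dot-++ {n} {p} A B α β =
  let take≡α , drop≡β = ++-injective (take p (α ++ β)) α (take++drop≡id p (α ++ β))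
  in cong₂ (λ α′ β′ → sumFin n (λ i → A (α′ ∷ʳ i) *ℚ B (i ∷ β′))) take≡α drop≡β

sumFin-stochasticˡ : ∀ m n (a : Fin m → Fin n → ℚ) (b : Fin n → ℚ) → (∀ i → sumFin m (λ j → a j i) ≡ 1ℚ) →
  sumFin m (λ j → sumFin n (λ i → a j i *ℚ b i)) ≡ sumFin n b
sumFin-stochasticˡ m n a b columns = begin
  sumFin m (λ j → sumFin n (λ i → a j i *ℚ b i))  ≡⟨ sumFin-comm m n _ ⟩
  sumFin n (λ i → sumFin m (λ j → a j i *ℚ b i))  ≡⟨ sumFin-cong n (λ i → sumFin-*ʳ m (b i) (λ j → a j i)) ⟨
  sumFin n (λ i → sumFin m (λ j → a j i) *ℚ b i)  ≡⟨ sumFin-cong n (λ i → cong (_*ℚ b i) (columns i)) ⟩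
  sumFin n (λ i → 1ℚ *ℚ b i)                      ≡⟨ sumFin-cong n (λ i → ℚ.*-identityˡ (b i)) ⟩
  sumFin n b                                      ∎

sumFin-stochasticʳ : ∀ m n (a : Fin n → ℚ) (b : Fin n → Fin m → ℚ) → (∀ i → sumFin m (b i) ≡ 1ℚ) →
  sumFin m (λ j → sumFin n (λ i → a i *ℚ b i j)) ≡ sumFin n a
sumFin-stochasticʳ m n a b rows = begin
  sumFin m (λ j → sumFin n (λ i → a i *ℚ b i j))  ≡⟨ sumFin-comm m n _ ⟩
  sumFin n (λ i → sumFin m (λ j → a i *ℚ b i j))  ≡⟨ sumFin-cong n (λ i → sumFin-*ˡ m (a i) (b i)) ⟨
  sumFin n (λ i → a i *ℚ sumFin m (b i))          ≡⟨ sumFin-cong n (λ i → cong (a i *ℚ_) (rows i)) ⟩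
  sumFin n (λ i → a i *ℚ 1ℚ)                      ≡⟨ sumFin-cong n (λ i → ℚ.*-identityʳ (a i)) ⟩
  sumFin n a                                      ∎

dot-polystochastic : {A : Matrix n (suc p)} {B : Matrix n (suc q)} →
  IsPolystochastic A → IsPolystochastic B → IsPolystochastic (dot A B)
dot-polystochastic {n} {p} {q} {A} {B} PA PB = nonNeg , ++-lines {E = dot A B} left right
  where
  nonNeg : ∀ γ → 0ℚ ≤ℚ dot A B γ
  nonNeg γ = sumFin-nonNeg n (λ i → *-nonNeg (proj₁ PA _) (proj₁ PB _))

  left : ∀ (α : Index n p) β k → sumFin n (λ m → dot A B ((α [ k ]≔ m) ++ β)) ≡ 1ℚ
  left α β k = begin
    sumFin n (λ m → dot A B ((α [ k ]≔ m) ++ β))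
      ≡⟨ sumFin-cong n (λ m → dot-++ A B (α [ k ]≔ m) β) ⟩
    sumFin n (λ m → sumFin n (λ i → A ((α [ k ]≔ m) ∷ʳ i) *ℚ B (i ∷ β)))
      ≡⟨ sumFin-stochasticˡ n n _ _ (innerLine-sum PA α k) ⟩
    sumFin n (λ i → B (i ∷ β))
      ≡⟨ firstLine-sum PB (lookup α k) β ⟩
    1ℚ ∎

  right : ∀ (α : Index n p) β k → sumFin n (λ m → dot A B (α ++ (β [ k ]≔ m))) ≡ 1ℚ
  right α β k = begin
    sumFin n (λ m → dot A B (α ++ (β [ k ]≔ m)))
      ≡⟨ sumFin-cong n (λ m → dot-++ A B α (β [ k ]≔ m)) ⟩
    sumFin n (λ m → sumFin n (λ i → A (α ∷ʳ i) *ℚ B (i ∷ (β [ k ]≔ m))))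
      ≡⟨ sumFin-stochasticʳ n n _ _ (λ i → proj₂ PB (suc k) (i ∷ β)) ⟩
    sumFin n (λ i → A (α ∷ʳ i))
      ≡⟨ lastLine-sum PA α (lookup β k) ⟩
    1ℚ ∎

dot-selects : {A : Matrix n (suc p)} (B : Matrix n (suc q)) → IsPolystochastic A →
  ∀ {α i} β → A (α ∷ʳ i) ≡ 1ℚ → dot A B (α ++ β) ≡ B (i ∷ β)
dot-selects {n} {A = A} B PA {α} {i} β Aαi≡1 = begin
  dot A B (α ++ β)                          ≡⟨ dot-++ A B α β ⟩
  sumFin n (λ l → A (α ∷ʳ l) *ℚ B (l ∷ β))
    ≡⟨ sumFin-select n _ (λ l → proj₁ PA _) (lastLine-sum PA α i) Aαi≡1 ⟩
  B (i ∷ β)                                 ∎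

dot-combinationʳ : (A : Matrix n (suc p)) {E C D : Matrix n (suc q)} (t s : ℚ) →
  (∀ δ → E δ ≡ t *ℚ C δ +ℚ s *ℚ D δ) → ∀ γ → dot A E γ ≡ t *ℚ dot A C γ +ℚ s *ℚ dot A D γ
dot-combinationʳ {n} {p} A {E} {C} {D} t s E≡tC+sD γ = begin
  sumFin n (λ i → a i *ℚ E (i ∷ β))
    ≡⟨ sumFin-cong n (λ i → trans (cong (a i *ℚ_) (E≡tC+sD (i ∷ β)))
                                  (distribute (a i) (C (i ∷ β)) (D (i ∷ β)))) ⟩
  sumFin n (λ i → t *ℚ (a i *ℚ C (i ∷ β)) +ℚ s *ℚ (a i *ℚ D (i ∷ β)))
    ≡⟨ sumFin-+ n _ _ ⟩
  sumFin n (λ i → t *ℚ (a i *ℚ C (i ∷ β))) +ℚ sumFin n (λ i → s *ℚ (a i *ℚ D (i ∷ β)))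
    ≡⟨ cong₂ _+ℚ_ (sumFin-*ˡ n t _) (sumFin-*ˡ n s _) ⟨
  t *ℚ sumFin n (λ i → a i *ℚ C (i ∷ β)) +ℚ s *ℚ sumFin n (λ i → a i *ℚ D (i ∷ β)) ∎
  where
  a : Fin n → ℚ
  a i = A (take p γ ∷ʳ i)
  β : Index n _
  β = drop p γ
  distribute : ∀ x c d → x *ℚ (t *ℚ c +ℚ s *ℚ d) ≡ t *ℚ (x *ℚ c) +ℚ s *ℚ (x *ℚ d)
  distribute x c d =
    solve 5 (λ x t c s d → x :* (t :* c :+ s :* d) := t :* (x :* c) :+ s :* (x :* d)) refl x t c s d
    where open +-*-Solver

slice : Matrix n (p + q) → Index n p → Fin p → Matrix n (suc q)
slice E α k (j ∷ β) = E ((α [ k ]≔ j) ++ β)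

slice-polystochastic : {E : Matrix n (p + q)} → IsPolystochastic E →
  ∀ α k → IsPolystochastic (slice {q = q} E α k)
slice-polystochastic {n} {p} {q} {E} PE α k = (λ { (j ∷ β) → proj₁ PE _ }) , lines
  where
  lines : ∀ l δ → sumFin n (λ m → slice {q = q} E α k (δ [ l ]≔ m)) ≡ 1ℚ
  lines zero    (j ∷ β) =
    trans (sumFin-cong n (λ m → cong E (sym ([]≔-++-↑ˡ α β k)))) (proj₂ PE (k ↑ˡ q) (α ++ β))
  lines (suc l) (j ∷ β) =
    trans (sumFin-cong n (λ m → cong E (sym ([]≔-++-↑ʳ (α [ k ]≔ j) β l))))
          (proj₂ PE (p ↑ʳ l) ((α [ k ]≔ j) ++ β))

-- Indices are swapped so that dot contracts the varying coordinate j with the first index of a slice.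
plane : Matrix n (suc p) → Index n p → Fin p → Matrix n 2
plane A α k (i ∷ j ∷ []) = A ((α [ k ]≔ j) ∷ʳ i)

plane-polystochastic : {A : Matrix n (suc p)} → IsPolystochastic A →
  ∀ α k → IsPolystochastic (plane A α k)
plane-polystochastic {n} {p} {A} PA α k = (λ { (i ∷ j ∷ []) → proj₁ PA _ }) , lines
  where
  lines : ∀ l δ → sumFin n (λ m → plane A α k (δ [ l ]≔ m)) ≡ 1ℚ
  lines zero       (i ∷ j ∷ []) = lastLine-sum PA (α [ k ]≔ j) i
  lines (suc zero) (i ∷ j ∷ []) = innerLine-sum PA α k i

module Restriction {A : Matrix n (suc p)} (PA : IsPermutation A) (α : Index n p) (k : Fin p) {q : ℕ} where

  restrict : Matrix n (p + q) → Matrix n (suc q)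
  restrict E = dot (plane A α k) (slice {q = q} E α k)

  restrict-polystochastic : {E : Matrix n (p + q)} → IsPolystochastic E → IsPolystochastic (restrict E)
  restrict-polystochastic PE =
    dot-polystochastic (plane-polystochastic (proj₁ PA) α k) (slice-polystochastic PE α k)

  restrict-combination : {E C D : Matrix n (p + q)} (t s : ℚ) → (∀ γ → E γ ≡ t *ℚ C γ +ℚ s *ℚ D γ) →
    ∀ δ → restrict E δ ≡ t *ℚ restrict C δ +ℚ s *ℚ restrict D δ
  restrict-combination {E} {C} {D} t s E≡tC+sD =
    dot-combinationʳ (plane A α k) {slice E α k} {slice C α k} {slice D α k} t s (λ { (j ∷ β) → E≡tC+sD _ })

  restrict-at : ∀ {i} → A (α ∷ʳ i) ≡ 1ℚ →
    (E : Matrix n (p + q)) (β : Index n q) → restrict E (i ∷ β) ≡ E (α ++ β)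
  restrict-at {i = i} Aαi≡1 E β = begin
    restrict E (i ∷ β)
      ≡⟨ dot-selects (slice E α k) (plane-polystochastic (proj₁ PA) α k) {i ∷ []} β plane≡1 ⟩
    E ((α [ k ]≔ lookup α k) ++ β)      ≡⟨ cong (λ α′ → E (α′ ++ β)) ([]≔-lookup α k) ⟩
    E (α ++ β)                          ∎
    where
    plane≡1 : plane A α k (i ∷ lookup α k ∷ []) ≡ 1ℚ
    plane≡1 = trans (cong (λ α′ → A (α′ ∷ʳ i)) ([]≔-lookup α k)) Aαi≡1

  restrict-dot : (B : Matrix n (suc q)) → ∀ δ → restrict (dot A B) δ ≡ B δ
  restrict-dot B (i ∷ β) = begin
    sumFin n (λ j → A (x j ∷ʳ i) *ℚ dot A B (x j ++ β))  ≡⟨ sumFin-cong n (λ j → weighted (x j)) ⟩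
    sumFin n (λ j → A (x j ∷ʳ i) *ℚ B (i ∷ β))           ≡⟨ sumFin-*ʳ n (B (i ∷ β)) _ ⟨
    sumFin n (λ j → A (x j ∷ʳ i)) *ℚ B (i ∷ β)
      ≡⟨ cong (_*ℚ B (i ∷ β)) (innerLine-sum (proj₁ PA) α k i) ⟩
    1ℚ *ℚ B (i ∷ β)                                      ≡⟨ ℚ.*-identityˡ (B (i ∷ β)) ⟩
    B (i ∷ β)                                            ∎
    where
    x : Fin n → Index n p
    x j = α [ k ]≔ j
    weighted : ∀ α′ → A (α′ ∷ʳ i) *ℚ dot A B (α′ ++ β) ≡ A (α′ ∷ʳ i) *ℚ B (i ∷ β)
    weighted α′ with proj₂ PA (α′ ∷ʳ i)
    ... | inj₁ a≡0 rewrite a≡0 = trans (ℚ.*-zeroˡ (dot A B (α′ ++ β))) (sym (ℚ.*-zeroˡ (B (i ∷ β))))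
    ... | inj₂ a≡1 = cong (A (α′ ∷ʳ i) *ℚ_) (dot-selects B (proj₁ PA) β a≡1)

-- IsVertex B unfolds to IsPolystochastic B × ¬ ProperDecomposition B.
ProperDecomposition : {d : ℕ} → Matrix n d → Set
ProperDecomposition {n} {d} B =
  Σ (Matrix n d) λ C → Σ (Matrix n d) λ D → Σ ℚ λ t →
    IsPolystochastic C × IsPolystochastic D ×
    (0ℚ <ℚ t) × (t <ℚ 1ℚ) ×
    (Σ (Index n d) λ α → C α ≢ D α) ×
    ((α : Index n d) → B α ≡ (t *ℚ C α) +ℚ ((1ℚ -ℚ t) *ℚ D α))

dot-decomposition⇒decomposition : {A : Matrix n (suc (suc p))} {B : Matrix n (suc q)} →
  IsPermutation A → ProperDecomposition (dot A B) → ProperDecomposition B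
dot-decomposition⇒decomposition {n} {p} {q} {A} {B} PA
  (C , D , t , PC , PD , 0<t , t<1 , (γ , Cγ≢Dγ) , AB≡tC+sD) =
  restrict C , restrict D , t , restrict-polystochastic PC , restrict-polystochastic PD , 0<t , t<1 ,
  (i ∷ β , Cγ≢Dγ ∘ separated) ,
  λ δ → trans (sym (restrict-dot B δ)) (restrict-combination t (1ℚ -ℚ t) AB≡tC+sD δ)
  where
  α : Index n (suc p)
  α = take (suc p) γ
  β : Index n q
  β = drop (suc p) γ
  open Restriction PA α zero
  row : ∃ λ i → A (α ∷ʳ i) ≡ 1ℚ
  row = sumFin≡1⇒∃≡1 n (λ i → proj₂ PA (α ∷ʳ i)) (lastLine-sum (proj₁ PA) α (head γ))
  i : Fin n
  i = proj₁ row
  separated : restrict C (i ∷ β) ≡ restrict D (i ∷ β) → C γ ≡ D γ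
  separated eq = begin
    C γ                 ≡⟨ cong C (take++drop≡id (suc p) γ) ⟨
    C (α ++ β)          ≡⟨ restrict-at (proj₂ row) C β ⟨
    restrict C (i ∷ β)  ≡⟨ eq ⟩
    restrict D (i ∷ β)  ≡⟨ restrict-at (proj₂ row) D β ⟩
    D (α ++ β)          ≡⟨ cong D (take++drop≡id (suc p) γ) ⟩
    D γ                 ∎

theorem2 : (p q n : ℕ) → 1 ≤ p → 1 ≤ q → 1 ≤ n →
    (A : Matrix n (suc p)) (B : Matrix n (suc q)) →
    IsPermutation A → IsVertex B → IsVertex (dot A B)
theorem2 (suc p) q n (s≤s z≤n) _ _ A B PA (PB , B-extreme) =
  dot-polystochastic (proj₁ PA) PB , B-extreme ∘ dot-decomposition⇒decomposition PA
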